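{- Let $P_{4,2}$ be the L-tetromino (a $1\times3$ row of unit squares together with one unit square adjacent to an end square of the row, perpendicular to it). Then $\tau(P_{4,2})=(1,5,11,\infty)$, i.e. $P_{4,2}$ is a $(1,1)$-winner, a $(1,2)$-loser, a $(2,5)$-winner, a $(2,6)$-loser, a $(3,11)$-winner, a $(3,12)$-loser, and an $(n,b)$-winner for all $n\ge4$ and all $b\ge0$.
   Context: The board is the tiling of the plane by unit squares (cells); cells are adjacent if they share an edge. A polyomino is a finite connected set of cells up to congruence. In the weak $(a,b)$ achievement game ($a\ge1,b\ge0$) for a goal polyomino $A$ on the infinite board, maker and breaker alternately mark previously unmarked cells, maker first, $a$ resp. $b$ cells per turn; the maker wins if his marked cells at some point contain a set congruent to $A$; $A$ is an $(a,b)$-winner if the maker has a strategy guaranteeing a win in finitely many turns against every breaker play, otherwise an $(a,b)$-loser. The threshold sequence $\tau(A)=(b_1,b_2,\ldots)$ has $b_n$ the greatest $b$ for which $A$ is an $(n,b)$-winner ($\infty$ if for all $b$); $(b_1,\ldots,b_{k-1},\infty)$ denotes the sequence with $b_n=\infty$ for all $n\ge k$. -}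

module Defs where

open import Data.Bool using (Bool; true; false)
open import Data.Nat using (ℕ; _≤_)
open import Data.Integer using (ℤ; +_; -_) renaming (_+_ to _+ℤ_)
open import Data.Product using (_×_; _,_; ∃-syntax)
open import Data.Sum using (_⊎_)
open import Data.List using (List; []; _∷_; _++_; map; length)
open import Data.List.Membership.Propositional using (_∈_; _∉_)
open import Data.List.Relation.Unary.All using (All)
open import Data.List.Relation.Unary.Unique.Propositional using (Unique)
open import Relation.Binary.PropositionalEquality using (_≡_)
open import Relation.Nullary using (¬_)

-- A cell of the infinite square board, identified with its lower-left corner.
Cell : Set
Cell = ℤ × ℤ

-- The 8 symmetries of the square lattice fixing the origin:
-- optional swap of coordinates, then optional negation of each coordinate.
record Sym : Set where
  constructor sym
  field
    swap  : Bool
    negx  : Bool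
    negy  : Bool

neg? : Bool → ℤ → ℤ
neg? true  z = - z
neg? false z = z

applySym : Sym → Cell → Cell
applySym (sym true  nx ny) (x , y) = neg? nx y , neg? ny x
applySym (sym false nx ny) (x , y) = neg? nx x , neg? ny y

translate : Cell → Cell → Cell
translate (dx , dy) (x , y) = (dx +ℤ x , dy +ℤ y)

image : Sym → Cell → List Cell → List Cell
image s t A = map (λ c → translate t (applySym s c)) A

ContainsCopy : List Cell → List Cell → Set
ContainsCopy A S = ∃[ s ] ∃[ t ] All (_∈ S) (image s t A)

LegalTurn : ℕ → List Cell → List Cell → Set
LegalTurn k marked m = (length m ≡ k) × Unique m × All (_∉ marked) m

-- MakerWins a b A M B : in the weak (a,b) achievement game for goal A,
-- with maker's marked cells M and breaker's marked cells B and maker to move,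
-- maker has a strategy guaranteeing a win in finitely many turns against
-- every breaker play.  (Inductive: every play following the strategy is finite.)
data MakerWins (a b : ℕ) (A : List Cell) : List Cell → List Cell → Set where
  turn : ∀ {M B} (m : List Cell) → LegalTurn a (M ++ B) m →
         (ContainsCopy A (m ++ M) ⊎
          (∀ (r : List Cell) → LegalTurn b (m ++ M ++ B) r →
             MakerWins a b A (m ++ M) (r ++ B))) →
         MakerWins a b A M B

Winner : ℕ → ℕ → List Cell → Set
Winner a b A = MakerWins a b A [] []

Loser : ℕ → ℕ → List Cell → Set
Loser a b A = ¬ Winner a b A

LTetromino : List Cell
LTetromino = (+ 0 , + 0) ∷ (+ 1 , + 0) ∷ (+ 2 , + 0) ∷ (+ 0 , + 1) ∷ []

-- b_n(A) = β  (β finite): A is an (n,β)-winner and an (n,b)-loser for all b > β.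
ThresholdIs : List Cell → ℕ → ℕ → Set
ThresholdIs A n β = Winner n β A × (∀ b → β Data.Nat.< b → Loser n b A)

-- b_n(A) = ∞: A is an (n,b)-winner for all b.
ThresholdInf : List Cell → ℕ → Set
ThresholdInf A n = ∀ b → Winner n b A

module Submission where

-- The winner halves are explicit maker strategies closed by a packing
-- argument: if maker has more pairwise disjoint one-move completions of an L
-- than breaker has marked cells, one of them is untouched (unblockedOption,
-- winByPacking).  For n ≥ 4 maker marks a whole L at once; for (3,11) and
-- (2,5) a single opening move creates enough completions; for (1,1) maker
-- first builds a straight tromino.  The loser halves are breaker strategies
-- preserving an invariant of positions (loserByInvariant): against (1,b≥2)
-- breaker guards both horizontal neighbours of every maker cell, so maker
-- never gets a horizontal domino, which every L contains; for a ≤ 2, b ≥ 3a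
-- breaker marks all but one well-chosen neighbour of each new maker cell
-- (LeftOpen); for a ≤ 3, b ≥ 4a breaker marks all neighbours (Sealed).

open import Defs
open import Data.Nat using (ℕ; _≤_)
open import Data.Product using (_×_)

open import Data.Bool using (Bool; true; false; not)
open import Data.Bool.Properties using (not-involutive)
open import Data.Nat using (_≟_; zero; suc; _+_; _*_; _∸_; _<_; z≤n; s≤s)
open import Data.Nat.Properties using (≤-refl; ≤-pred; ≤-trans; m≤m+n; m≤n+m; <-irrefl; m∸n+n≡m; +-suc; *-suc; *-zeroʳ; ≤⇒≯)
open import Data.Integer using (+_; -[1+_]; ∣_∣)
import Data.Integer.Properties as ℤ
open import Algebra.Properties.AbelianGroup ℤ.+-0-abelianGroup using (∙-cancelˡ)
open import Data.Product using (∃-syntax; _,_; proj₁; proj₂)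
open import Data.Product.Properties using (≡-dec)
open import Data.Sum using (_⊎_; inj₁; inj₂; [_,_]′; map₁; map₂)
open import Data.List using (List; []; _∷_; _++_; length; map; concat; concatMap; filter; deduplicate)
open import Data.List.Properties using (length-++; length-map; length-filter; length-deduplicate)
open import Data.List.Relation.Unary.All as All using (All; []; _∷_)
open import Data.List.Relation.Unary.All.Properties using (¬Any⇒All¬; All¬⇒¬Any)
open import Data.List.Relation.Unary.Any using (here; there; any?)
open import Data.List.Relation.Unary.Unique.Propositional using (Unique; []; _∷_)
open import Data.List.Membership.Propositional using (_∈_; _∉_; find)
open import Data.List.Membership.Propositional.Properties
  using (∈-++⁺ˡ; ∈-++⁺ʳ; ∈-++⁻; ∈-concat⁺′; ∈-map⁺; ∈-map⁻; ∈-filter⁺; ∈-filter⁻; ∈-deduplicate⁺; ∈-deduplicate⁻)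
open import Relation.Binary.Definitions using (DecidableEquality)
open import Relation.Binary.PropositionalEquality using (module ≡-Reasoning; _≡_; _≢_; refl; trans; subst; cong; cong₂)
  renaming (sym to ≡-sym)
open import Data.Empty using (⊥; ⊥-elim)
open import Relation.Nullary using (¬_; Dec; yes; no; ¬?)
open import Relation.Nullary.Decidable using (map′; _×-dec_; True; toWitness)

_≟ᶜ_ : DecidableEquality Cell
_≟ᶜ_ = ≡-dec ℤ._≟_ ℤ._≟_

open import Data.List.Membership.DecPropositional _≟ᶜ_ using (_∈?_)
open import Data.List.Relation.Unary.Unique.DecPropositional _≟ᶜ_ using (unique?)
open import Data.List.Relation.Unary.Unique.DecPropositional.Properties _≟ᶜ_ using (deduplicate-!)

deleteOne : ∀ {h : Cell} {B : List Cell} → h ∈ B →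
            ∃[ B' ] (length B ≡ suc (length B') × (∀ {z} → z ∈ B → z ≡ h ⊎ z ∈ B'))
deleteOne {B = x ∷ B} (here refl) = B , refl , λ { (here p) → inj₁ p ; (there q) → inj₂ q }
deleteOne {B = x ∷ B} (there h∈B) with deleteOne h∈B
... | B' , len , cover = x ∷ B' , cong suc len , λ { (here q) → inj₂ (here q)
                                                    ; (there q) → map₂ there (cover q) }

pigeonhole : ∀ (xs ys : List Cell) → Unique xs → All (_∈ ys) xs → length xs ≤ length ys
pigeonhole [] ys _ _ = z≤n
pigeonhole (x ∷ xs) ys (x∉xs ∷ xs!) (x∈ys ∷ xs⊆ys) with deleteOne x∈ys
... | ys' , len , cover = subst (suc (length xs) ≤_) (≡-sym len)
        (s≤s (pigeonhole xs ys' xs! (All.zipWith shrink (x∉xs , xs⊆ys))))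
  where
  shrink : ∀ {z} → x ≢ z × z ∈ ys → z ∈ ys'
  shrink (x≢z , z∈ys) = [ (λ z≡x → ⊥-elim (x≢z (≡-sym z≡x))) , (λ q → q) ]′ (cover z∈ys)

unique-++ʳ : ∀ (xs : List Cell) {ys} → Unique (xs ++ ys) → Unique ys
unique-++ʳ [] ys! = ys!
unique-++ʳ (x ∷ xs) (_ ∷ xs++ys!) = unique-++ʳ xs xs++ys!

unique-++-disjoint : ∀ (xs : List Cell) {ys x y} → Unique (xs ++ ys) → x ∈ xs → y ∈ ys → x ≢ y
unique-++-disjoint (x ∷ xs) (x∉ ∷ _) (here refl) y∈ys = All.lookup x∉ (∈-++⁺ʳ xs y∈ys)
unique-++-disjoint (x ∷ xs) (_ ∷ xs++ys!) (there x∈xs) y∈ys = unique-++-disjoint xs xs++ys! x∈xs y∈ys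

unblockedOption : ∀ (Cs : List (List Cell)) → Unique (concat Cs) → (B : List Cell) →
                  length B < length Cs → ∃[ C ] (C ∈ Cs × All (_∉ B) C)
unblockedOption (C ∷ Cs) Cs! B |B|<|Cs| with any? (_∈? B) C
... | no C∩B=∅ = C , here refl , ¬Any⇒All¬ C C∩B=∅
... | yes C∩B≠∅ with find C∩B≠∅
...   | h , h∈C , h∈B with deleteOne h∈B
...     | B' , len , cover
        with unblockedOption Cs (unique-++ʳ C Cs!) B' (≤-pred (subst (_< length (C ∷ Cs)) len |B|<|Cs|))
...       | C' , C'∈Cs , C'∩B'=∅ = C' , there C'∈Cs , All.tabulate avoidsB
  where
  avoidsB : ∀ {z} → z ∈ C' → z ∉ B
  avoidsB z∈C' z∈B = [ (λ z≡h → unique-++-disjoint C Cs! h∈C (∈-concat⁺′ z∈C' C'∈Cs) (≡-sym z≡h))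
                     , All.lookup C'∩B'=∅ z∈C' ]′ (cover z∈B)

length-concatMap : ∀ (f : Cell → List Cell) k → (∀ x → length (f x) ≡ k) →
                   ∀ m → length (concatMap f m) ≡ k * length m
length-concatMap f k |f|≡k [] = ≡-sym (*-zeroʳ k)
length-concatMap f k |f|≡k (x ∷ m) = begin
  length (f x ++ concatMap f m)          ≡⟨ length-++ (f x) {concatMap f m} ⟩
  length (f x) + length (concatMap f m)  ≡⟨ cong₂ _+_ (|f|≡k x) (length-concatMap f k |f|≡k m) ⟩
  k + k * length m                       ≡⟨ ≡-sym (*-suc k (length m)) ⟩
  k * suc (length m)                     ∎
  where open ≡-Reasoning

-- Cells far to the right of every cell of a list are not in it.
fresh : (avoid : List Cell) → ∃[ c ] c ∉ avoid
fresh avoid = (+ suc (reach avoid) , + 0) , λ c∈avoid → <-irrefl refl (reach-∈ c∈avoid)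
  where
  reach : List Cell → ℕ
  reach [] = 0
  reach ((x , _) ∷ cs) = ∣ x ∣ + reach cs
  reach-∈ : ∀ {c cs} → c ∈ cs → ∣ proj₁ c ∣ ≤ reach cs
  reach-∈ (here refl) = m≤m+n _ _
  reach-∈ (there c∈cs) = ≤-trans (reach-∈ c∈cs) (m≤n+m _ _)

extendByFresh : (marked : List Cell) (k : ℕ) (r : List Cell) → Unique r → All (_∉ marked) r →
  ∃[ r' ] (Unique r' × All (_∉ marked) r' × length r' ≡ k + length r × (∀ {d} → d ∈ r → d ∈ r'))
extendByFresh marked zero r r! r-free = r , r! , r-free , refl , λ p → p
extendByFresh marked (suc k) r r! r-free with fresh (marked ++ r)
... | c , c-fresh with extendByFresh marked k (c ∷ r)
        (All.tabulate (λ c'∈r c≡c' → c-fresh (∈-++⁺ʳ marked (subst (_∈ r) (≡-sym c≡c') c'∈r))) ∷ r!)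
        ((λ c∈marked → c-fresh (∈-++⁺ˡ c∈marked)) ∷ r-free)
...   | r' , r'! , r'-free , len , ext = r' , r'! , r'-free , trans len (+-suc k (length r)) , λ p → ext (there p)

unmarkedPart : (marked D : List Cell) →
  ∃[ r ] (Unique r × All (_∉ marked) r × length r ≤ length D × (∀ {d} → d ∈ D → d ∈ r ⊎ d ∈ marked))
unmarkedPart marked D =
  r , deduplicate-! (filter unmarked? D) , All.tabulate unmarked , |r|≤|D| , cover
  where
  unmarked? : (z : Cell) → Dec (z ∉ marked)
  unmarked? z = ¬? (z ∈? marked)
  r : List Cell
  r = deduplicate _≟ᶜ_ (filter unmarked? D)
  unmarked : ∀ {z} → z ∈ r → z ∉ marked
  unmarked z∈r = proj₂ (∈-filter⁻ unmarked? {xs = D} (∈-deduplicate⁻ _≟ᶜ_ (filter unmarked? D) z∈r))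
  |r|≤|D| : length r ≤ length D
  |r|≤|D| = ≤-trans (length-deduplicate _≟ᶜ_ (filter unmarked? D)) (length-filter unmarked? D)
  cover : ∀ {d} → d ∈ D → d ∈ r ⊎ d ∈ marked
  cover {d} d∈D with d ∈? marked
  ... | yes d∈marked = inj₂ d∈marked
  ... | no d∉marked = inj₁ (∈-deduplicate⁺ _≟ᶜ_ (∈-filter⁺ unmarked? d∈D d∉marked))

-- A player can always make a legal b-turn that covers a given list D of at
-- most b cells: it marks the unmarked cells of D, padded with fresh cells.
markAll : ∀ (b : ℕ) (marked D : List Cell) → length D ≤ b →
          ∃[ r ] (LegalTurn b marked r × (∀ {d} → d ∈ D → d ∈ r ⊎ d ∈ marked))
markAll b marked D |D|≤b with unmarkedPart marked D
... | r₀ , r₀! , r₀-free , |r₀|≤|D| , cover₀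
    with extendByFresh marked (b ∸ length r₀) r₀ r₀! r₀-free
...   | r , r! , r-free , len , ext =
        r , (trans len (m∸n+n≡m (≤-trans |r₀|≤|D| |D|≤b)) , r! , r-free) , cover
  where
  cover : ∀ {d} → d ∈ D → d ∈ r ⊎ d ∈ marked
  cover d∈D = map₁ ext (cover₀ d∈D)

data Dir : Set where
  right left up down : Dir

delta : Dir → Cell
delta right = (+ 1 , + 0)
delta left  = (-[1+ 0 ] , + 0)
delta up    = (+ 0 , + 1)
delta down  = (+ 0 , -[1+ 0 ])

opposite : Dir → Dir
opposite right = left
opposite left  = right
opposite up    = down
opposite down  = up

infixl 6 _+ᵈ_
_+ᵈ_ : Cell → Dir → Cell
c +ᵈ d = translate c (delta d)

origin : Cell
origin = (+ 0 , + 0)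

translate-assoc : ∀ (t p q : Cell) → translate (translate t p) q ≡ translate t (translate p q)
translate-assoc (tx , ty) (px , py) (qx , qy) = cong₂ _,_ (ℤ.+-assoc tx px qx) (ℤ.+-assoc ty py qy)

translate-origin : ∀ (t : Cell) → translate t origin ≡ t
translate-origin (tx , ty) = cong₂ _,_ (ℤ.+-identityʳ tx) (ℤ.+-identityʳ ty)

translate-cancelˡ : ∀ (t p q : Cell) → translate t p ≡ translate t q → p ≡ q
translate-cancelˡ (tx , ty) (px , py) (qx , qy) eq =
  cong₂ _,_ (∙-cancelˡ tx px qx (cong proj₁ eq)) (∙-cancelˡ ty py qy (cong proj₂ eq))

-- The ℓ¹-length of a displacement separates the displacements we compare:
-- 0 (staying), 1 (one step) and 2 (two equal steps).
∥_∥ : Cell → ℕ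
∥ (x , y) ∥ = ∣ x ∣ + ∣ y ∣

∥delta∥ : ∀ d → ∥ delta d ∥ ≡ 1
∥delta∥ right = refl
∥delta∥ left  = refl
∥delta∥ up    = refl
∥delta∥ down  = refl

∥delta+delta∥ : ∀ d → ∥ translate (delta d) (delta d) ∥ ≡ 2
∥delta+delta∥ right = refl
∥delta+delta∥ left  = refl
∥delta+delta∥ up    = refl
∥delta+delta∥ down  = refl

translate-≢ : ∀ t p q → ∥ p ∥ ≢ ∥ q ∥ → translate t p ≢ translate t q
translate-≢ t p q ∥p∥≢∥q∥ eq = ∥p∥≢∥q∥ (cong ∥_∥ (translate-cancelˡ t p q eq))

+ᵈ-+ᵈ : ∀ c d e → c +ᵈ d +ᵈ e ≡ translate c (translate (delta d) (delta e))
+ᵈ-+ᵈ c d e = translate-assoc c (delta d) (delta e)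

step-≢ : ∀ c d → c +ᵈ d ≢ c
step-≢ c d eq = translate-≢ c (delta d) origin (subst (_≢ 0) (≡-sym (∥delta∥ d)) λ ())
                  (trans eq (≡-sym (translate-origin c)))

twoSteps-≢ : ∀ c d → c +ᵈ d +ᵈ d ≢ c
twoSteps-≢ c d eq = translate-≢ c _ origin (subst (_≢ 0) (≡-sym (∥delta+delta∥ d)) λ ())
                      (trans (≡-sym (+ᵈ-+ᵈ c d d)) (trans eq (≡-sym (translate-origin c))))

oneStep≢twoSteps : ∀ c u v → c +ᵈ v ≢ c +ᵈ u +ᵈ u
oneStep≢twoSteps c u v eq = translate-≢ c (delta v) _ ∥v∥≢∥2u∥ (trans eq (+ᵈ-+ᵈ c u u))
  where
  ∥v∥≢∥2u∥ : ∥ delta v ∥ ≢ ∥ translate (delta u) (delta u) ∥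
  ∥v∥≢∥2u∥ rewrite ∥delta∥ v | ∥delta+delta∥ u = λ ()

delta-injective : ∀ {d e} → delta d ≡ delta e → d ≡ e
delta-injective {d} {e} eq = trans (≡-sym (direction-delta d)) (trans (cong direction eq) (direction-delta e))
  where
  direction : Cell → Dir
  direction (+ 1 , _)       = right
  direction (-[1+ 0 ] , _)  = left
  direction (_ , + 1)       = up
  direction _               = down
  direction-delta : ∀ d → direction (delta d) ≡ d
  direction-delta right = refl
  direction-delta left  = refl
  direction-delta up    = refl
  direction-delta down  = refl

+ᵈ-injective : ∀ c {u v} → c +ᵈ u ≡ c +ᵈ v → u ≡ v
+ᵈ-injective c eq = delta-injective (translate-cancelˡ c _ _ eq)

+ᵈ-opposite : ∀ c d → c +ᵈ d +ᵈ opposite d ≡ c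
+ᵈ-opposite c d = trans (+ᵈ-+ᵈ c d (opposite d)) (trans (cong (translate c) (cancels d)) (translate-origin c))
  where
  cancels : ∀ d → translate (delta d) (delta (opposite d)) ≡ origin
  cancels right = refl
  cancels left  = refl
  cancels up    = refl
  cancels down  = refl

_≟ᵈ_ : DecidableEquality Dir
d ≟ᵈ e = map′ delta-injective (cong delta) (delta d ≟ᶜ delta e)

horizontal : Dir → Bool
horizontal right = true
horizontal left  = true
horizontal up    = false
horizontal down  = false

Perp : Dir → Dir → Set
Perp u v = horizontal u ≡ not (horizontal v)

¬Perp-self : ∀ u → ¬ Perp u u
¬Perp-self right ()
¬Perp-self left  ()
¬Perp-self up    ()
¬Perp-self down  ()

-- An L-tetromino inside S, described intrinsically: a corner c, two steps
-- along the long arm u and one step along the perpendicular short arm v.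
record LShape (S : List Cell) : Set where
  constructor lshape
  field
    corner     : Cell
    long short : Dir
    perp       : Perp long short
    ∈corner    : corner ∈ S
    ∈long₁     : corner +ᵈ long ∈ S
    ∈long₂     : corner +ᵈ long +ᵈ long ∈ S
    ∈short     : corner +ᵈ short ∈ S

lshapeAt : ∀ {S} t p u v → Perp u v → translate t p ∈ S →
           translate t (translate p (delta u)) ∈ S →
           translate t (translate (translate p (delta u)) (delta u)) ∈ S →
           translate t (translate p (delta v)) ∈ S → LShape S
lshapeAt {S} t p u v u⊥v c₀ c₁ c₂ c₃ =
  lshape (translate t p) u v u⊥v c₀ (subst (_∈ S) (≡-sym (translate-assoc t p (delta u))) c₁)
    (subst (_∈ S) (≡-sym (trans (cong (_+ᵈ u) (translate-assoc t p (delta u)))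
                                (translate-assoc t (translate p (delta u)) (delta u)))) c₂)
    (subst (_∈ S) (≡-sym (translate-assoc t p (delta v))) c₃)

-- Every congruent copy of the L-tetromino is an LShape: the eight lattice
-- symmetries send the arms (right, up) to the eight perpendicular pairs.
copy⇒LShape : ∀ {S} → ContainsCopy LTetromino S → LShape S
copy⇒LShape (sym false false false , t , c₀ ∷ c₁ ∷ c₂ ∷ c₃ ∷ []) = lshapeAt t _ right up   refl c₀ c₁ c₂ c₃
copy⇒LShape (sym false true  false , t , c₀ ∷ c₁ ∷ c₂ ∷ c₃ ∷ []) = lshapeAt t _ left  up   refl c₀ c₁ c₂ c₃
copy⇒LShape (sym false false true  , t , c₀ ∷ c₁ ∷ c₂ ∷ c₃ ∷ []) = lshapeAt t _ right down refl c₀ c₁ c₂ c₃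
copy⇒LShape (sym false true  true  , t , c₀ ∷ c₁ ∷ c₂ ∷ c₃ ∷ []) = lshapeAt t _ left  down refl c₀ c₁ c₂ c₃
copy⇒LShape (sym true  false false , t , c₀ ∷ c₁ ∷ c₂ ∷ c₃ ∷ []) = lshapeAt t _ up    right refl c₀ c₁ c₂ c₃
copy⇒LShape (sym true  true  false , t , c₀ ∷ c₁ ∷ c₂ ∷ c₃ ∷ []) = lshapeAt t _ up    left refl c₀ c₁ c₂ c₃
copy⇒LShape (sym true  false true  , t , c₀ ∷ c₁ ∷ c₂ ∷ c₃ ∷ []) = lshapeAt t _ down  right refl c₀ c₁ c₂ c₃
copy⇒LShape (sym true  true  true  , t , c₀ ∷ c₁ ∷ c₂ ∷ c₃ ∷ []) = lshapeAt t _ down  left refl c₀ c₁ c₂ c₃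

noLShape[] : ¬ LShape []
noLShape[] (lshape _ _ _ _ () _ _ _)

module LCells (c₀ : Cell) (u v : Dir) (u⊥v : Perp u v) where
  c₁ c₂ c₃ : Cell
  c₁ = c₀ +ᵈ u
  c₂ = c₁ +ᵈ u
  c₃ = c₀ +ᵈ v

  c₀≢c₁ : c₀ ≢ c₁
  c₀≢c₁ eq = step-≢ c₀ u (≡-sym eq)
  c₀≢c₂ : c₀ ≢ c₂
  c₀≢c₂ eq = twoSteps-≢ c₀ u (≡-sym eq)
  c₀≢c₃ : c₀ ≢ c₃
  c₀≢c₃ eq = step-≢ c₀ v (≡-sym eq)
  c₁≢c₂ : c₁ ≢ c₂
  c₁≢c₂ eq = step-≢ c₁ u (≡-sym eq)
  c₁≢c₃ : c₁ ≢ c₃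
  c₁≢c₃ eq = ¬Perp-self u (subst (Perp u) (≡-sym (+ᵈ-injective c₀ eq)) u⊥v)
  c₂≢c₃ : c₂ ≢ c₃
  c₂≢c₃ eq = oneStep≢twoSteps c₀ u v (≡-sym eq)

  distinct : Unique (c₀ ∷ c₁ ∷ c₂ ∷ c₃ ∷ [])
  distinct = (c₀≢c₁ ∷ c₀≢c₂ ∷ c₀≢c₃ ∷ []) ∷ (c₁≢c₂ ∷ c₁≢c₃ ∷ []) ∷ (c₂≢c₃ ∷ []) ∷ [] ∷ []

horizontalArm : ∀ u v → Perp u v → horizontal u ≡ true ⊎ horizontal v ≡ true
horizontalArm u v u⊥v with horizontal u
... | true  = inj₁ refl
... | false = inj₂ (trans (≡-sym (not-involutive (horizontal v))) (cong not (≡-sym u⊥v)))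

rightDomino : ∀ {S} c d → horizontal d ≡ true → c ∈ S → c +ᵈ d ∈ S →
              ∃[ c' ] (c' ∈ S × c' +ᵈ right ∈ S)
rightDomino c right _ c∈S c'∈S = c , c∈S , c'∈S
rightDomino {S} c left _ c∈S c'∈S = c +ᵈ left , c'∈S , subst (_∈ S) (≡-sym (+ᵈ-opposite c left)) c∈S

horizontalDomino : ∀ {S} → LShape S → ∃[ c ] (c ∈ S × c +ᵈ right ∈ S)
horizontalDomino (lshape c u v u⊥v c∈S cu∈S _ cv∈S) with horizontalArm u v u⊥v
... | inj₁ u-horizontal = rightDomino c u u-horizontal c∈S cu∈S
... | inj₂ v-horizontal = rightDomino c v v-horizontal c∈S cv∈S

-- A breaker strategy given by an invariant Inv M B of positions (maker's cells
-- M, breaker's cells B): against every legal maker turn m, maker's cells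
-- contain no L and breaker has a legal reply re-establishing Inv.
BreakerKeeps : ℕ → ℕ → (List Cell → List Cell → Set) → Set
BreakerKeeps a b Inv = ∀ M B m → Inv M B → LegalTurn a (M ++ B) m →
  ¬ LShape (m ++ M) × ∃[ r ] (LegalTurn b (m ++ M ++ B) r × Inv (m ++ M) (r ++ B))

loserByInvariant : ∀ a b (Inv : List Cell → List Cell → Set) → Inv [] [] →
                   BreakerKeeps a b Inv → Loser a b LTetromino
loserByInvariant a b Inv inv₀ keeps = refute inv₀
  where
  refute : ∀ {M B} → Inv M B → MakerWins a b LTetromino M B → ⊥
  refute {M} {B} inv (turn m legal (inj₁ copy)) = proj₁ (keeps M B m inv legal) (copy⇒LShape copy)
  refute {M} {B} inv (turn m legal (inj₂ continue))
    with _ , r , legal′ , inv′ ← keeps M B m inv legal = refute inv′ (continue r legal′)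

∈-afterRound : ∀ (m M B r : List Cell) {z} → z ∈ r ⊎ z ∈ m ++ M ++ B → z ∈ (m ++ M) ++ (r ++ B)
∈-afterRound m M B r (inj₁ z∈r) = ∈-++⁺ʳ (m ++ M) (∈-++⁺ˡ z∈r)
∈-afterRound m M B r (inj₂ z∈mMB) with ∈-++⁻ m z∈mMB
... | inj₁ z∈m = ∈-++⁺ˡ (∈-++⁺ˡ z∈m)
... | inj₂ z∈MB with ∈-++⁻ M z∈MB
...   | inj₁ z∈M = ∈-++⁺ˡ (∈-++⁺ʳ m z∈M)
...   | inj₂ z∈B = ∈-++⁺ʳ (m ++ M) (∈-++⁺ʳ r z∈B)

∈-afterRound-old : ∀ (m M B r : List Cell) {z} → z ∈ M ++ B → z ∈ (m ++ M) ++ (r ++ B)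
∈-afterRound-old m M B r z∈MB = ∈-afterRound m M B r (inj₂ (∈-++⁺ʳ m z∈MB))

-- (1,b) for b ≥ 2: breaker marks both horizontal neighbours of each maker cell,
-- so maker never gets a horizontal domino, which every L contains.
RowGuarded : List Cell → List Cell → Set
RowGuarded M B = (∀ {u} → u ∈ M → u +ᵈ right ∈ M ++ B × u +ᵈ left ∈ M ++ B)
               × (∀ {u} → u ∈ M → u +ᵈ right ∉ M)

loser1 : ∀ b → 1 < b → Loser 1 b LTetromino
loser1 b 2≤b = loserByInvariant 1 b RowGuarded ((λ ()) , (λ ())) keeps
  where
  keeps : BreakerKeeps 1 b RowGuarded
  keeps M B (x ∷ []) (guarded , noDomino) (refl , _ , x-free ∷ [])
    with markAll b (x ∷ M ++ B) (x +ᵈ right ∷ x +ᵈ left ∷ []) 2≤b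
  ... | r , legal , marks = noL , r , legal , (guarded′ , noDomino′)
    where
    noDomino′ : ∀ {c} → c ∈ x ∷ M → c +ᵈ right ∉ x ∷ M
    noDomino′ (here refl) (here eq) = step-≢ x right eq
    noDomino′ (here refl) (there q) =
      x-free (subst (_∈ M ++ B) (+ᵈ-opposite x right) (proj₂ (guarded q)))
    noDomino′ (there p) (here eq) = x-free (subst (_∈ M ++ B) eq (proj₁ (guarded p)))
    noDomino′ (there p) (there q) = noDomino p q
    noL : ¬ LShape (x ∷ M)
    noL L = let c , c∈ , c+right∈ = horizontalDomino L in noDomino′ c∈ c+right∈
    guarded′ : ∀ {u} → u ∈ x ∷ M → u +ᵈ right ∈ (x ∷ M) ++ (r ++ B) × u +ᵈ left ∈ (x ∷ M) ++ (r ++ B)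
    guarded′ (here refl) = ∈-afterRound (x ∷ []) M B r (marks (here refl))
                         , ∈-afterRound (x ∷ []) M B r (marks (there (here refl)))
    guarded′ (there p) = ∈-afterRound-old (x ∷ []) M B r (proj₁ (guarded p))
                       , ∈-afterRound-old (x ∷ []) M B r (proj₂ (guarded p))

neighbours : Cell → List Cell
neighbours c = c +ᵈ right ∷ c +ᵈ left ∷ c +ᵈ up ∷ c +ᵈ down ∷ []

∈-neighbours : ∀ c d → c +ᵈ d ∈ neighbours c
∈-neighbours c right = here refl
∈-neighbours c left  = there (here refl)
∈-neighbours c up    = there (there (here refl))
∈-neighbours c down  = there (there (there (here refl)))

neighbourhood : List Cell → List Cell
neighbourhood = concatMap neighbours

∈-neighbourhood : ∀ {c m} → c ∈ m → ∀ d → c +ᵈ d ∈ neighbourhood m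
∈-neighbourhood {c} c∈m d = ∈-concat⁺′ (∈-neighbours c d) (∈-map⁺ neighbours c∈m)

-- (a,b) for a ≤ 3 and b ≥ 4a: breaker marks all neighbours of maker's new
-- cells.  Invariant: maker has no L and every neighbour of a maker cell is marked.
Sealed : List Cell → List Cell → Set
Sealed M B = ¬ LShape M × (∀ {u} → u ∈ M → ∀ d → u +ᵈ d ∈ M ++ B)

sealedApart : ∀ {M B m} → Sealed M B → All (_∉ M ++ B) m → ∀ {c} d → c ∈ M → c +ᵈ d ∉ m
sealedApart (_ , sealed) m-free d c∈M c+d∈m = All.lookup m-free c+d∈m (sealed c∈M d)

sealedApart′ : ∀ {M B m} → Sealed M B → All (_∉ M ++ B) m → ∀ {c} d → c ∈ m → c +ᵈ d ∉ M
sealedApart′ {m = m} sealedMB m-free {c} d c∈m c+d∈M =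
  sealedApart sealedMB m-free (opposite d) c+d∈M (subst (_∈ m) (≡-sym (+ᵈ-opposite c d)) c∈m)

-- Hence an L among maker's cells after a turn of at most three new cells
-- cannot mix old and new cells, and cannot consist of new cells only.
sealedNoNewL : ∀ {M B} m → Sealed M B → All (_∉ M ++ B) m → length m < 4 → ¬ LShape (m ++ M)
sealedNoNewL m sealedMB m-free |m|<4 (lshape c₀ u v u⊥v p₀ p₁ p₂ p₃)
  with ∈-++⁻ m p₀ | ∈-++⁻ m p₁ | ∈-++⁻ m p₂ | ∈-++⁻ m p₃
... | inj₁ q₀ | inj₁ q₁ | inj₁ q₂ | inj₁ q₃ =
      ≤⇒≯ (pigeonhole _ m (LCells.distinct c₀ u v u⊥v) (q₀ ∷ q₁ ∷ q₂ ∷ q₃ ∷ [])) |m|<4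
... | inj₂ q₀ | inj₂ q₁ | inj₂ q₂ | inj₂ q₃ = proj₁ sealedMB (lshape c₀ u v u⊥v q₀ q₁ q₂ q₃)
... | inj₁ q₀ | inj₂ q₁ | _       | _       = sealedApart′ sealedMB m-free u q₀ q₁
... | inj₂ q₀ | inj₁ q₁ | _       | _       = sealedApart sealedMB m-free u q₀ q₁
... | inj₁ q₀ | inj₁ q₁ | inj₂ q₂ | _       = sealedApart′ sealedMB m-free u q₁ q₂
... | inj₂ q₀ | inj₂ q₁ | inj₁ q₂ | _       = sealedApart sealedMB m-free u q₁ q₂
... | inj₁ q₀ | inj₁ q₁ | inj₁ q₂ | inj₂ q₃ = sealedApart′ sealedMB m-free v q₀ q₃
... | inj₂ q₀ | inj₂ q₁ | inj₂ q₂ | inj₁ q₃ = sealedApart sealedMB m-free v q₀ q₃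

loserSealing : ∀ a b → a < 4 → 4 * a ≤ b → Loser a b LTetromino
loserSealing a b a<4 4a≤b = loserByInvariant a b Sealed (noLShape[] , (λ ())) keeps
  where
  keeps : BreakerKeeps a b Sealed
  keeps M B m sealedMB (refl , _ , m-free)
    with markAll b (m ++ M ++ B) (neighbourhood m)
           (subst (_≤ b) (≡-sym (length-concatMap neighbours 4 (λ _ → refl) m)) 4a≤b)
  ... | r , legal , marks = noL , r , legal , (noL , sealed′)
    where
    noL : ¬ LShape (m ++ M)
    noL = sealedNoNewL m sealedMB m-free a<4
    sealed′ : ∀ {c} → c ∈ m ++ M → ∀ d → c +ᵈ d ∈ (m ++ M) ++ (r ++ B)
    sealed′ c∈ d with ∈-++⁻ m c∈
    ... | inj₁ c∈m = ∈-afterRound m M B r (marks (∈-neighbourhood c∈m d))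
    ... | inj₂ c∈M = ∈-afterRound-old m M B r (proj₂ sealedMB c∈M d)

-- (a,b) for a ≤ 2 and b ≥ 3a: at each new maker cell x breaker marks three
-- neighbours, leaving open one towards a maker cell if x has a maker neighbour,
-- and the left one otherwise.
LeftOpen : List Cell → List Cell → Set
LeftOpen M B = ¬ LShape M
             × (∀ {u} → u ∈ M → ∀ d → d ≢ left → u +ᵈ d ∈ M ++ B)
             × (∀ {u} → u ∈ M → ∀ d → u +ᵈ d ∈ M → u +ᵈ left ∈ M ++ B)

leftOpenApart : ∀ {M B m} → LeftOpen M B → All (_∉ M ++ B) m →
                ∀ {w} d → w ∈ M → w +ᵈ d ∈ m → d ≡ left × (∀ d' → w +ᵈ d' ∉ M)
leftOpenApart (_ , _ , joined) m-free left w∈M w+d∈m =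
  refl , λ d' w+d'∈M → All.lookup m-free w+d∈m (joined w∈M d' w+d'∈M)
leftOpenApart (_ , guarded , _) m-free right w∈M w+d∈m = ⊥-elim (All.lookup m-free w+d∈m (guarded w∈M right λ ()))
leftOpenApart (_ , guarded , _) m-free up    w∈M w+d∈m = ⊥-elim (All.lookup m-free w+d∈m (guarded w∈M up λ ()))
leftOpenApart (_ , guarded , _) m-free down  w∈M w+d∈m = ⊥-elim (All.lookup m-free w+d∈m (guarded w∈M down λ ()))

leftOpenApart′ : ∀ {M B m} → LeftOpen M B → All (_∉ M ++ B) m →
                 ∀ {c} d → c ∈ m → c +ᵈ d ∈ M → opposite d ≡ left × (∀ d' → c +ᵈ d +ᵈ d' ∉ M)
leftOpenApart′ {m = m} inv m-free {c} d c∈m c+d∈M =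
  leftOpenApart inv m-free (opposite d) c+d∈M (subst (_∈ m) (≡-sym (+ᵈ-opposite c d)) c∈m)

oppositeLeft : ∀ {d} → opposite d ≡ left → d ≡ right
oppositeLeft {right} _ = refl

¬Perp-equal : ∀ {u v w} → u ≡ w → v ≡ w → ¬ Perp u v
¬Perp-equal refl refl = ¬Perp-self _

-- Hence a turn of at most two new cells creates no L: three new cells would
-- be needed, and every way of mixing old and new cells violates the
-- adjacency constraints above.
leftOpenNoNewL : ∀ {M B} m → LeftOpen M B → All (_∉ M ++ B) m → length m < 3 → ¬ LShape (m ++ M)
leftOpenNoNewL {M} m inv m-free |m|<3 (lshape c₀ u v u⊥v p₀ p₁ p₂ p₃) =
  mixed (∈-++⁻ m p₀) (∈-++⁻ m p₁) (∈-++⁻ m p₂) (∈-++⁻ m p₃)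
  where
  open LCells c₀ u v u⊥v
  threeNew : ∀ {x y z} → x ≢ y → x ≢ z → y ≢ z → x ∈ m → y ∈ m → z ∈ m → ⊥
  threeNew x≢y x≢z y≢z x∈m y∈m z∈m =
    ≤⇒≯ (pigeonhole _ m ((x≢y ∷ x≢z ∷ []) ∷ (y≢z ∷ []) ∷ [] ∷ []) (x∈m ∷ y∈m ∷ z∈m ∷ [])) |m|<3
  apart : ∀ {w} d → w ∈ M → w +ᵈ d ∈ m → d ≡ left × (∀ d' → w +ᵈ d' ∉ M)
  apart = leftOpenApart inv m-free
  apart′ : ∀ {c} d → c ∈ m → c +ᵈ d ∈ M → opposite d ≡ left × (∀ d' → c +ᵈ d +ᵈ d' ∉ M)
  apart′ = leftOpenApart′ inv m-free
  mixed : c₀ ∈ m ⊎ c₀ ∈ M → c₁ ∈ m ⊎ c₁ ∈ M → c₂ ∈ m ⊎ c₂ ∈ M → c₃ ∈ m ⊎ c₃ ∈ M → ⊥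
  mixed (inj₁ n₀) (inj₁ n₁) (inj₁ n₂) _         = threeNew c₀≢c₁ c₀≢c₂ c₁≢c₂ n₀ n₁ n₂
  mixed (inj₁ n₀) (inj₁ n₁) (inj₂ o₂) (inj₁ n₃) = threeNew c₀≢c₁ c₀≢c₃ c₁≢c₃ n₀ n₁ n₃
  mixed (inj₁ n₀) (inj₂ o₁) (inj₁ n₂) (inj₁ n₃) = threeNew c₀≢c₂ c₀≢c₃ c₂≢c₃ n₀ n₂ n₃
  mixed (inj₂ o₀) (inj₁ n₁) (inj₁ n₂) (inj₁ n₃) = threeNew c₁≢c₂ c₁≢c₃ c₂≢c₃ n₁ n₂ n₃
  mixed (inj₂ o₀) (inj₂ o₁) (inj₂ o₂) (inj₂ o₃) = proj₁ inv (lshape c₀ u v u⊥v o₀ o₁ o₂ o₃)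
  mixed (inj₁ n₀) (inj₁ n₁) (inj₂ o₂) (inj₂ o₃) =
    ¬Perp-equal (oppositeLeft (proj₁ (apart′ u n₁ o₂))) (oppositeLeft (proj₁ (apart′ v n₀ o₃))) u⊥v
  mixed (inj₁ n₀) (inj₂ o₁) (inj₁ n₂) (inj₂ o₃) with refl ← proj₁ (apart u o₁ n₂)
    with () ← proj₁ (apart′ u n₀ o₁)
  mixed (inj₁ n₀) (inj₂ o₁) (inj₂ o₂) _         = proj₂ (apart′ u n₀ o₁) u o₂
  mixed (inj₂ o₀) (inj₁ n₁) _         (inj₂ o₃) = proj₂ (apart u o₀ n₁) v o₃
  mixed (inj₂ o₀) (inj₁ n₁) (inj₂ o₂) (inj₁ n₃) =
    ¬Perp-equal (proj₁ (apart u o₀ n₁)) (proj₁ (apart v o₀ n₃)) u⊥v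
  mixed (inj₂ o₀) (inj₂ o₁) _         (inj₁ n₃) = proj₂ (apart v o₀ n₃) u o₁
  mixed (inj₂ o₀) (inj₂ o₁) (inj₁ n₂) (inj₂ o₃) =
    proj₂ (apart u o₁ n₂) (opposite u) (subst (_∈ M) (≡-sym (+ᵈ-opposite c₀ u)) o₀)

allDirs : List Dir
allDirs = right ∷ left ∷ up ∷ down ∷ []

∈-allDirs : ∀ d → d ∈ allDirs
∈-allDirs right = here refl
∈-allDirs left  = there (here refl)
∈-allDirs up    = there (there (here refl))
∈-allDirs down  = there (there (there (here refl)))

OpenSide : Cell → List Cell → Dir → Set
OpenSide x S d₀ = x +ᵈ d₀ ∈ S ⊎ (d₀ ≡ left × (∀ d → x +ᵈ d ∉ S))

openSide : ∀ x S → ∃[ d₀ ] OpenSide x S d₀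
openSide x S with any? (λ d → x +ᵈ d ∈? S) allDirs
... | yes hasNeighbour = let d₀ , _ , x+d₀∈S = find hasNeighbour in d₀ , inj₁ x+d₀∈S
... | no noNeighbour =
      left , inj₂ (refl , λ d → All.lookup (¬Any⇒All¬ allDirs noNeighbour) (∈-allDirs d))

otherNeighbours : Cell → Dir → List Cell
otherNeighbours x d₀ = map (x +ᵈ_) (filter (λ d → ¬? (d ≟ᵈ d₀)) allDirs)

∈-otherNeighbours : ∀ x {d₀} d → d ≢ d₀ → x +ᵈ d ∈ otherNeighbours x d₀
∈-otherNeighbours x {d₀} d d≢d₀ = ∈-map⁺ (x +ᵈ_) (∈-filter⁺ (λ d → ¬? (d ≟ᵈ d₀)) (∈-allDirs d) d≢d₀)

length-otherNeighbours : ∀ x d₀ → length (otherNeighbours x d₀) ≡ 3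
length-otherNeighbours x right = refl
length-otherNeighbours x left  = refl
length-otherNeighbours x up    = refl
length-otherNeighbours x down  = refl

guardCells : List Cell → List Cell → List Cell
guardCells S = concatMap (λ x → otherNeighbours x (proj₁ (openSide x S)))

length-guardCells : ∀ S m → length (guardCells S m) ≡ 3 * length m
length-guardCells S = length-concatMap _ 3 (λ x → length-otherNeighbours x (proj₁ (openSide x S)))

∈-guardCells : ∀ S {x m} → x ∈ m → ∀ d → d ≢ proj₁ (openSide x S) → x +ᵈ d ∈ guardCells S m
∈-guardCells S {x} x∈m d d≢d₀ = ∈-concat⁺′ (∈-otherNeighbours x d d≢d₀) (∈-map⁺ _ x∈m)

openSideGuards : ∀ {x S T d₀} → OpenSide x S d₀ → (∀ {z} → z ∈ S → z ∈ T) →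
                 (∀ d → d ≢ d₀ → x +ᵈ d ∈ T) →
                 (∀ d → d ≢ left → x +ᵈ d ∈ T) × (∀ d → x +ᵈ d ∈ S → x +ᵈ left ∈ T)
openSideGuards {x} {S} {T} {d₀} (inj₁ x+d₀∈S) S⊆T othersMarked = guarded , joined
  where
  marked : ∀ d → x +ᵈ d ∈ T
  marked d with d ≟ᵈ d₀
  ... | yes refl = S⊆T x+d₀∈S
  ... | no d≢d₀ = othersMarked d d≢d₀
  guarded : ∀ d → d ≢ left → x +ᵈ d ∈ T
  guarded d _ = marked d
  joined : ∀ d → x +ᵈ d ∈ S → x +ᵈ left ∈ T
  joined _ _ = marked left
openSideGuards (inj₂ (refl , isolated)) _ othersMarked =
  othersMarked , λ d x+d∈S → ⊥-elim (isolated d x+d∈S)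

loserLeftOpen : ∀ a b → a < 3 → 3 * a ≤ b → Loser a b LTetromino
loserLeftOpen a b a<3 3a≤b =
  loserByInvariant a b LeftOpen (noLShape[] , (λ ()) , (λ ())) keeps
  where
  keeps : BreakerKeeps a b LeftOpen
  keeps M B m inv (refl , _ , m-free)
    with markAll b (m ++ M ++ B) (guardCells (m ++ M) m)
           (subst (_≤ b) (≡-sym (length-guardCells (m ++ M) m)) 3a≤b)
  ... | r , legal , marks = noL , r , legal , (noL , guarded′ , joined′)
    where
    noL : ¬ LShape (m ++ M)
    noL = leftOpenNoNewL m inv m-free a<3
    guardsNew : ∀ {x} → x ∈ m → (∀ d → d ≢ left → x +ᵈ d ∈ (m ++ M) ++ (r ++ B))
                              × (∀ d → x +ᵈ d ∈ m ++ M → x +ᵈ left ∈ (m ++ M) ++ (r ++ B))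
    guardsNew {x} x∈m = openSideGuards {x = x} (proj₂ (openSide x (m ++ M))) ∈-++⁺ˡ
      (λ d d≢d₀ → ∈-afterRound m M B r (marks (∈-guardCells (m ++ M) x∈m d d≢d₀)))
    guarded′ : ∀ {u} → u ∈ m ++ M → ∀ d → d ≢ left → u +ᵈ d ∈ (m ++ M) ++ (r ++ B)
    guarded′ u∈ d d≢left with ∈-++⁻ m u∈
    ... | inj₁ u∈m = proj₁ (guardsNew u∈m) d d≢left
    ... | inj₂ u∈M = ∈-afterRound-old m M B r (proj₁ (proj₂ inv) u∈M d d≢left)
    joined′ : ∀ {u} → u ∈ m ++ M → ∀ d → u +ᵈ d ∈ m ++ M → u +ᵈ left ∈ (m ++ M) ++ (r ++ B)
    joined′ u∈ d u+d∈ with ∈-++⁻ m u∈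
    ... | inj₁ u∈m = proj₂ (guardsNew u∈m) d u+d∈
    ... | inj₂ u∈M with ∈-++⁻ m u+d∈
    ...   | inj₂ u+d∈M = ∈-afterRound-old m M B r (proj₂ (proj₂ inv) u∈M d u+d∈M)
    ...   | inj₁ u+d∈m with refl ← proj₁ (leftOpenApart inv m-free d u∈M u+d∈m) = ∈-++⁺ˡ u+d∈

-- A candidate finishing move for maker: cells to mark which, together with
-- maker's cells, contain the copy of the L given by a symmetry and a shift.
record Completion : Set where
  constructor completion
  field
    cells    : List Cell
    symmetry : Sym
    shift    : Cell
open Completion

Completes : ℕ → List Cell → Completion → Set
Completes a M e = length (cells e) ≡ a × Unique (cells e) × All (_∉ M) (cells e)
                × All (_∈ cells e ++ M) (image (symmetry e) (shift e) LTetromino)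

completes? : ∀ a M e → Dec (Completes a M e)
completes? a M e = (length (cells e) ≟ a) ×-dec unique? (cells e)
                 ×-dec All.all? (λ z → ¬? (z ∈? M)) (cells e)
                 ×-dec All.all? (_∈? cells e ++ M) (image (symmetry e) (shift e) LTetromino)

-- A list of pairwise disjoint a-cell completions for maker's cells M,
-- certified by evaluating the decision procedures.
Certified : ℕ → List Cell → List Completion → Set
Certified a M es = True (All.all? (completes? a M) es) × True (unique? (concat (map cells es)))

∉-++⁺ : ∀ {z : Cell} M {B} → z ∉ M → z ∉ B → z ∉ M ++ B
∉-++⁺ M z∉M z∉B z∈MB = [ z∉M , z∉B ]′ (∈-++⁻ M z∈MB)

winByPacking : ∀ {a b M B} es → Certified a M es → length B < length es →
               MakerWins a b LTetromino M B
winByPacking {M = M} {B} es (all-complete , disjoint) |B|<|es|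
  with unblockedOption (map cells es) (toWitness disjoint) B
         (subst (length B <_) (≡-sym (length-map cells es)) |B|<|es|)
... | C , C∈ , C-free with ∈-map⁻ cells C∈
...   | e , e∈es , refl with All.lookup (toWitness all-complete) e∈es
...     | |e| , e! , e-free , copy =
          turn (cells e) (|e| , e! , All.zipWith (λ (p , q) → ∉-++⁺ M p q) (e-free , C-free))
               (inj₁ (symmetry e , shift e , copy))

winAfterOpening : ∀ {a b M B} m → LegalTurn a (M ++ B) m → ∀ es → Certified a (m ++ M) es →
                  suc (b + length B) ≤ length es → MakerWins a b LTetromino M B
winAfterOpening {B = B} m legal es certified bound = turn m legal (inj₂ λ r legal′ →
  winByPacking es certified (subst (λ k → suc k ≤ length es)
    (≡-sym (trans (length-++ r) (cong (_+ length B) (proj₁ legal′)))) bound))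

legalOpening : ∀ m → Unique m → LegalTurn (length m) [] m
legalOpening m m! = refl , m! , All.tabulate (λ _ ())

winnerMany : ∀ n b → 4 ≤ n → Winner n b LTetromino
winnerMany n b 4≤n with markAll n [] LTetromino 4≤n
... | m , legal , covers = turn m legal (inj₁ (sym false false false , origin , All.tabulate inM))
  where
  inM : ∀ {z} → z ∈ LTetromino → z ∈ m ++ []
  inM z∈L with covers z∈L
  ... | inj₁ z∈m = ∈-++⁺ˡ z∈m

-- Four pairwise disjoint three-cell completions of a single maker cell c:
-- the L's whose long arm starts at c and leaves it to the right, up, left
-- and down respectively.
pinwheel : Cell → List Completion
pinwheel c =
    completion (at (+ 1 , + 0) ∷ at (+ 2 , + 0) ∷ at (+ 2 , + 1) ∷ []) (sym false true false) (at (+ 2 , + 0))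
  ∷ completion (at (+ 0 , + 1) ∷ at (+ 0 , + 2) ∷ at (-[1+ 0 ] , + 2) ∷ []) (sym true true true) (at (+ 0 , + 2))
  ∷ completion (at (-[1+ 0 ] , + 0) ∷ at (-[1+ 1 ] , + 0) ∷ at (-[1+ 1 ] , -[1+ 0 ])  ∷ []) (sym false false true) (at (-[1+ 1 ] , + 0))
  ∷ completion (at (+ 0 , -[1+ 0 ]) ∷ at (+ 0 , -[1+ 1 ]) ∷ at (+ 1 , -[1+ 1 ]) ∷ []) (sym true false false) (at (+ 0 , -[1+ 1 ]))
  ∷ []
  where
  at : Cell → Cell
  at = translate c

-- (3,11): maker opens with three far apart cells, whose twelve pinwheel
-- completions are pairwise disjoint; breaker's eleven cells cannot meet all.
winner3 : Winner 3 11 LTetromino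
winner3 = winAfterOpening opening (legalOpening opening (toWitness {a? = unique? opening} _))
            (concatMap pinwheel opening) (_ , _) ≤-refl
  where
  opening : List Cell
  opening = (+ 0 , + 0) ∷ (+ 10 , + 0) ∷ (+ 20 , + 0) ∷ []

-- (2,5): maker opens with a horizontal domino, which has six pairwise
-- disjoint two-cell completions.
winner2 : Winner 2 5 LTetromino
winner2 = winAfterOpening domino (legalOpening domino (toWitness {a? = unique? domino} _))
            completions (_ , _) ≤-refl
  where
  domino : List Cell
  domino = (+ 0 , + 0) ∷ (+ 1 , + 0) ∷ []
  completions : List Completion
  completions =
      completion ((+ 1 , + 1) ∷ (+ 1 , + 2) ∷ []) (sym true true false) (+ 1 , + 0)
    ∷ completion ((+ 2 , -[1+ 0 ]) ∷ (+ 2 , + 0) ∷ []) (sym false true true) (+ 2 , + 0)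
    ∷ completion ((-[1+ 0 ] , -[1+ 0 ]) ∷ (-[1+ 0 ] , + 0) ∷ []) (sym false false true) (-[1+ 0 ] , + 0)
    ∷ completion ((+ 1 , -[1+ 1 ]) ∷ (+ 1 , -[1+ 0 ]) ∷ []) (sym true true true) (+ 1 , + 0)
    ∷ completion ((+ 0 , -[1+ 1 ]) ∷ (+ 0 , -[1+ 0 ]) ∷ []) (sym true false true) (+ 0 , + 0)
    ∷ completion ((+ 0 , + 1) ∷ (+ 0 , + 2) ∷ []) (sym true false false) (+ 0 , + 0)
    ∷ []

-- The four single-cell completions of a straight tromino, beside its end
-- cells: for the row c, c + (1,0), c + (2,0) and for the column c, c + (0,1), c + (0,2).
rowCompletions columnCompletions : Cell → List Completion
rowCompletions c =
    completion (at (+ 0 , -[1+ 0 ]) ∷ []) (sym false false true) (at (+ 0 , + 0))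
  ∷ completion (at (+ 0 , + 1) ∷ []) (sym false false false) (at (+ 0 , + 0))
  ∷ completion (at (+ 2 , -[1+ 0 ]) ∷ []) (sym false true true) (at (+ 2 , + 0))
  ∷ completion (at (+ 2 , + 1) ∷ []) (sym false true false) (at (+ 2 , + 0))
  ∷ []
  where
  at : Cell → Cell
  at = translate c
columnCompletions c =
    completion (at (-[1+ 0 ] , + 0) ∷ []) (sym true true false) (at (+ 0 , + 0))
  ∷ completion (at (-[1+ 0 ] , + 2) ∷ []) (sym true true true) (at (+ 0 , + 2))
  ∷ completion (at (+ 1 , + 0) ∷ []) (sym true false false) (at (+ 0 , + 0))
  ∷ completion (at (+ 1 , + 2) ∷ []) (sym true false true) (at (+ 0 , + 2))
  ∷ []
  where
  at : Cell → Cell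
  at = translate c

-- Maker holds the origin, breaker one cell B₁ that misses the cells n, e₁, e₂
-- of a line through the origin.  Maker marks n; breaker can block only one of
-- e₁, e₂, and maker marks the other, obtaining a straight tromino with four
-- disjoint single-cell completions against breaker's three cells.
extendAlongLine : ∀ {B₁} (n e₁ e₂ : Cell) (es₁ es₂ : List Completion) → length B₁ ≡ 1 →
  All (_∉ B₁) (n ∷ e₁ ∷ e₂ ∷ []) → True (unique? (e₁ ∷ e₂ ∷ n ∷ origin ∷ [])) →
  Certified 1 (e₁ ∷ n ∷ origin ∷ []) es₁ → Certified 1 (e₂ ∷ n ∷ origin ∷ []) es₂ →
  length es₁ ≡ 4 → length es₂ ≡ 4 → MakerWins 1 1 LTetromino (origin ∷ []) B₁
extendAlongLine {B₁} n e₁ e₂ es₁ es₂ |B₁| (n∉B₁ ∷ e₁∉B₁ ∷ e₂∉B₁ ∷ []) distinct cert₁ cert₂ |es₁| |es₂|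
  with toWitness distinct
... | (e₁≢e₂ ∷ e₁-new) ∷ e₂-new ∷ n-new ∷ [] ∷ [] =
  turn (n ∷ []) (refl , [] ∷ [] , ∉-++⁺ (origin ∷ []) (All¬⇒¬Any n-new) n∉B₁ ∷ [])
    (inj₂ λ r₂ legal₂ → third r₂ legal₂
      (unblockedOption ((e₁ ∷ []) ∷ (e₂ ∷ []) ∷ []) ((e₁≢e₂ ∷ []) ∷ [] ∷ []) r₂
        (subst (_< 2) (≡-sym (proj₁ legal₂)) ≤-refl)))
  where
  finish : ∀ r₂ → LegalTurn 1 (n ∷ origin ∷ B₁) r₂ → ∀ e es → e ∉ r₂ → e ∉ B₁ → e ∉ n ∷ origin ∷ [] →
           Certified 1 (e ∷ n ∷ origin ∷ []) es → length es ≡ 4 →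
           MakerWins 1 1 LTetromino (n ∷ origin ∷ []) (r₂ ++ B₁)
  finish r₂ (|r₂| , _) e es e∉r₂ e∉B₁ e-new cert |es| =
    winAfterOpening (e ∷ []) (refl , [] ∷ [] , ∉-++⁺ (n ∷ origin ∷ []) e-new (∉-++⁺ r₂ e∉r₂ e∉B₁) ∷ [])
      es cert bound
    where
    bound : suc (1 + length (r₂ ++ B₁)) ≤ length es
    bound rewrite length-++ r₂ {B₁} | |r₂| | |B₁| | |es| = ≤-refl
  third : ∀ r₂ → LegalTurn 1 (n ∷ origin ∷ B₁) r₂ →
          ∃[ C ] (C ∈ (e₁ ∷ []) ∷ (e₂ ∷ []) ∷ [] × All (_∉ r₂) C) →
          MakerWins 1 1 LTetromino (n ∷ origin ∷ []) (r₂ ++ B₁)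
  third r₂ legal₂ (_ , here refl , e∉r₂ ∷ []) =
    finish r₂ legal₂ e₁ es₁ e∉r₂ e₁∉B₁ (All¬⇒¬Any e₁-new) cert₁ |es₁|
  third r₂ legal₂ (_ , there (here refl) , e∉r₂ ∷ []) =
    finish r₂ legal₂ e₂ es₂ e∉r₂ e₂∉B₁ (All¬⇒¬Any e₂-new) cert₂ |es₂|

-- (1,1): maker marks the origin.  Breaker's single cell misses one of the
-- disjoint horizontal and vertical lines (1,0), (2,0), (-1,0) and
-- (0,1), (0,2), (0,-1); maker extends along that line.
winner1 : Winner 1 1 LTetromino
winner1 = turn (origin ∷ []) (refl , [] ∷ [] , (λ ()) ∷ []) (inj₂ λ r₁ legal₁ →
  secondTurn (r₁ ++ []) (trans (length-++ r₁) (cong (_+ 0) (proj₁ legal₁))))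
  where
  lines : List (List Cell)
  lines = ((+ 1 , + 0) ∷ (+ 2 , + 0) ∷ (-[1+ 0 ] , + 0) ∷ [])
        ∷ ((+ 0 , + 1) ∷ (+ 0 , + 2) ∷ (+ 0 , -[1+ 0 ]) ∷ []) ∷ []
  alongLine : ∀ B₁ → length B₁ ≡ 1 → ∃[ C ] (C ∈ lines × All (_∉ B₁) C) →
              MakerWins 1 1 LTetromino (origin ∷ []) B₁
  alongLine B₁ |B₁| (_ , here refl , free) =
    extendAlongLine (+ 1 , + 0) (+ 2 , + 0) (-[1+ 0 ] , + 0) (rowCompletions origin)
      (rowCompletions (-[1+ 0 ] , + 0)) |B₁| free _ (_ , _) (_ , _) refl refl
  alongLine B₁ |B₁| (_ , there (here refl) , free) =
    extendAlongLine (+ 0 , + 1) (+ 0 , + 2) (+ 0 , -[1+ 0 ]) (columnCompletions origin)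
      (columnCompletions (+ 0 , -[1+ 0 ])) |B₁| free _ (_ , _) (_ , _) refl refl
  secondTurn : ∀ B₁ → length B₁ ≡ 1 → MakerWins 1 1 LTetromino (origin ∷ []) B₁
  secondTurn B₁ |B₁| = alongLine B₁ |B₁| (unblockedOption lines (toWitness {a? = unique? (concat lines)} _) B₁
                     (subst (_< 2) (≡-sym |B₁|) ≤-refl))

proposition7p5 : ThresholdIs LTetromino 1 1
               × ThresholdIs LTetromino 2 5
               × ThresholdIs LTetromino 3 11
               × (∀ (n : ℕ) → 4 ≤ n → ThresholdInf LTetromino n)
proposition7p5 =
    (winner1 , loser1)
  , (winner2 , λ b 5<b → loserLeftOpen 2 b ≤-refl 5<b)
  , (winner3 , λ b 11<b → loserSealing 3 b ≤-refl 11<b)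
  , λ n 4≤n b → winnerMany n b 4≤n
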